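{- Let $T$ be an arborescence with root $r$, let $\psi:E(T)\to\mathbb{R}$, let $U$ be a finite set and $\phi:U\to V(T)$. Suppose that: (1) the root $r$ is labeled and has exactly one outgoing edge; (2) every internal vertex is unlabeled and has exactly two outgoing edges; (3) every leaf of $T$ is labeled; (4) for every $s,t\in U$, $\sum_{e\in P(\phi(s),\phi(t))}\psi(e)=0$, where $P(\phi(s),\phi(t))$ is the set of edges on the path from $\phi(s)$ to $\phi(t)$ in the undirected tree underlying $T$. Then $\psi$ is identically $0$.
   Context: An arborescence is a directed rooted tree whose edges all point away from the root. An internal vertex is one that is neither the root nor a leaf. A vertex $v\in V(T)$ is labeled if $v=\phi(u)$ for some $u\in U$. -}

module Defs where

open import Level using (Level)
open import Data.Nat using (ℕ; zero; suc)
open import Data.Fin using (Fin)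
open import Data.Bool using (Bool; true; false; T; if_then_else_)
open import Data.List using (List; []; _∷_)
open import Data.List.Relation.Unary.Unique.Propositional using (Unique)
open import Data.Product using (Σ; ∃; _×_; _,_)
open import Data.Sum using (_⊎_)
open import Relation.Nullary using (¬_)
open import Relation.Binary.PropositionalEquality using (_≡_; _≢_)
open import Algebra.Bundles using (CommutativeRing)

-- A finite digraph on vertex set Fin n is given by a (decidable, Bool-valued)
-- arc relation:  T (arc u v)  means there is an edge u → v.
Digraph : ℕ → Set
Digraph n = Fin n → Fin n → Bool

module _ {n : ℕ} (arc : Digraph n) where

  data DWalk : Fin n → Fin n → Set where
    here : ∀ {x} → DWalk x x
    step : ∀ {x z y} → T (arc x z) → DWalk z y → DWalk x y

  -- Arborescence with root r: the root has in-degree 0, every other vertex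
  -- has in-degree exactly 1, and every vertex is reachable from r by a
  -- directed path (equivalently: unique directed path from r to each vertex).
  record IsArborescence (r : Fin n) : Set where
    field
      root-indeg0  : ∀ u → ¬ T (arc u r)
      other-indeg1 : ∀ v → v ≢ r → Σ (Fin n) λ u → T (arc u v) × (∀ w → T (arc w v) → w ≡ u)
      reachable    : ∀ v → DWalk r v

  IsLeaf : Fin n → Set
  IsLeaf v = ∀ w → ¬ T (arc v w)

  IsInternal : Fin n → Fin n → Set
  IsInternal r v = v ≢ r × ¬ IsLeaf v

  OutDeg1 : Fin n → Set
  OutDeg1 v = Σ (Fin n) λ c → T (arc v c) × (∀ d → T (arc v d) → d ≡ c)

  OutDeg2 : Fin n → Set
  OutDeg2 v = Σ (Fin n) λ c₁ → Σ (Fin n) λ c₂ → c₁ ≢ c₂ × T (arc v c₁) × T (arc v c₂)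
              × (∀ d → T (arc v d) → d ≡ c₁ ⊎ d ≡ c₂)

  Adj : Fin n → Fin n → Set
  Adj x y = T (arc x y) ⊎ T (arc y x)

  data UWalk : Fin n → Fin n → Set where
    here : ∀ {x} → UWalk x x
    step : ∀ {x z y} → Adj x z → UWalk z y → UWalk x y

  vertices : ∀ {x y} → UWalk x y → List (Fin n)
  vertices {x} here       = x ∷ []
  vertices {x} (step _ w) = x ∷ vertices w

  IsPath : ∀ {x y} → UWalk x y → Set
  IsPath w = Unique (vertices w)

  module _ {c ℓ : Level} (R : CommutativeRing c ℓ) where
    open CommutativeRing R

    -- value of ψ on the (unique) edge joining adjacent vertices x,y
    -- (ψ on edge u → v is ψ u v; values at non-edges are irrelevant)
    edgeVal : (Fin n → Fin n → Carrier) → Fin n → Fin n → Carrier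
    edgeVal ψ x y = if arc x y then ψ x y else ψ y x

    walkSum : (Fin n → Fin n → Carrier) → ∀ {x y} → UWalk x y → Carrier
    walkSum ψ here = 0#
    walkSum ψ (step {x} {z} _ w) = edgeVal ψ x z + walkSum ψ w

module _ {c ℓ : Level} (R : CommutativeRing c ℓ) where
  open CommutativeRing R

  natMul : ℕ → Carrier → Carrier
  natMul zero x    = 0#
  natMul (suc k) x = x + natMul k x

  -- characteristic zero in the sense that the additive group is torsion-free
  -- (true for ℝ, ℚ, any field of characteristic 0)
  TorsionFree : Set (c Level.⊔ ℓ)
  TorsionFree = ∀ k x → natMul (suc k) x ≈ 0# → x ≈ 0#

{-# OPTIONS --safe #-}
-- Let h(v) be the sum of ψ along the directed path from the root to v. The
-- root and the leaves are labelled, so h vanishes there. If v is internal, with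
-- children c₁ ≠ c₂ and leaves l₁, l₂ below them, then the undirected path
-- l₁ … c₁ v c₂ … l₂ has sum (h l₁ − h v) + (h l₂ − h v) = −2 h v, which is 0 by
-- hypothesis; torsion-freeness gives h v = 0. Hence ψ(u, v) = h v − h u = 0 on
-- every edge. Finiteness is needed only to find a leaf below every vertex.
module Submission where

open import Defs
open import Level using (Level)
open import Data.Nat using (ℕ)
open import Data.Fin using (Fin)
open import Data.Bool using (T)
open import Data.Product using (Σ; _×_)
open import Relation.Binary.PropositionalEquality using (_≡_)
open import Relation.Nullary using (¬_)
open import Algebra.Bundles using (CommutativeRing)

open import Data.Nat as ℕ using (zero; suc; _≤_)
open import Data.Fin using (_≟_) renaming (zero to fzero; suc to fsuc)
open import Data.Fin.Properties using (injective⇒≤; any?)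
open import Data.Bool using (Bool; true; false; if_then_else_)
open import Data.List using (List; []; _∷_; length; lookup)
open import Data.List.Membership.Propositional.Properties using (∈-lookup)
open import Data.List.Relation.Unary.All as All using (All; []; _∷_)
open import Data.List.Relation.Unary.AllPairs using ([]; _∷_)
open import Data.List.Relation.Unary.Unique.Propositional using (Unique)
open import Data.Product using (_,_; proj₂)
open import Data.Sum using (_⊎_; inj₁; inj₂)
open import Data.Empty using (⊥-elim)
open import Relation.Nullary using (yes; no)
open import Relation.Nullary.Decidable using (T?)
open import Relation.Binary.PropositionalEquality as ≡ using (refl; subst; _≢_)
open import Algebra.Bundles using (CommutativeMonoid)
import Algebra.Properties.CommutativeSemigroup as CommutativeSemigroupProperties
import Relation.Binary.Reasoning.Setoid as SetoidReasoning

if-true : ∀ {a} {A : Set a} {b : Bool} {x y : A} → T b → (if b then x else y) ≡ x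
if-true {b = true} _ = refl

if-false : ∀ {a} {A : Set a} {b : Bool} {x y : A} → ¬ T b → (if b then x else y) ≡ y
if-false {b = true}  ¬b = ⊥-elim (¬b _)
if-false {b = false} _  = refl

lookup-injective : ∀ {a} {A : Set a} {xs : List A} → Unique xs →
                   ∀ i j → lookup xs i ≡ lookup xs j → i ≡ j
lookup-injective (_   ∷ _)  fzero    fzero    _  = refl
lookup-injective (x∉ ∷ _)  fzero    (fsuc j) eq = ⊥-elim (All.lookup x∉ (∈-lookup j) eq)
lookup-injective (x∉ ∷ _)  (fsuc i) fzero    eq = ⊥-elim (All.lookup x∉ (∈-lookup i) (≡.sym eq))
lookup-injective (_   ∷ xs!) (fsuc i) (fsuc j) eq = ≡.cong fsuc (lookup-injective xs! i j eq)

Unique⇒length≤ : ∀ {n} {xs : List (Fin n)} → Unique xs → length xs ≤ n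
Unique⇒length≤ {xs = xs} xs! = injective⇒≤ {f = lookup xs} (lookup-injective xs! _ _)

module _ {c ℓ : Level} (M : CommutativeMonoid c ℓ) where
  open CommutativeMonoid M
  open CommutativeSemigroupProperties commutativeSemigroup using (interchange)
  open SetoidReasoning setoid

  x≈ε∧x∙y≈ε⇒y≈ε : ∀ {x y} → x ≈ ε → x ∙ y ≈ ε → y ≈ ε
  x≈ε∧x∙y≈ε⇒y≈ε {x} {y} x≈ε x∙y≈ε = begin
    y     ≈⟨ identityˡ y ⟨
    ε ∙ y ≈⟨ ∙-congʳ x≈ε ⟨
    x ∙ y ≈⟨ x∙y≈ε ⟩
    ε     ∎

  pairwise-ε⇒x∙x≈ε : ∀ {x y z} → x ∙ y ≈ ε → x ∙ z ≈ ε → y ∙ z ≈ ε → x ∙ x ≈ ε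
  pairwise-ε⇒x∙x≈ε {x} {y} {z} x∙y≈ε x∙z≈ε y∙z≈ε = begin
    x ∙ x             ≈⟨ identityʳ (x ∙ x) ⟨
    (x ∙ x) ∙ ε       ≈⟨ ∙-congˡ y∙z≈ε ⟨
    (x ∙ x) ∙ (y ∙ z) ≈⟨ interchange x x y z ⟩
    (x ∙ y) ∙ (x ∙ z) ≈⟨ ∙-cong x∙y≈ε x∙z≈ε ⟩
    ε ∙ ε             ≈⟨ identityˡ ε ⟩
    ε                 ∎

module Walks {n : ℕ} (arc : Digraph n) where

  _++ᵈ_ : ∀ {x y z} → DWalk arc x y → DWalk arc y z → DWalk arc x z
  here     ++ᵈ q = q
  step e p ++ᵈ q = step e (p ++ᵈ q)

  unsnoc : ∀ {x z y} → T (arc x z) → DWalk arc z y → Σ (Fin n) λ q → DWalk arc x q × T (arc q y)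
  unsnoc e here = _ , here , e
  unsnoc e (step e′ w) with unsnoc e′ w
  ... | q , p , e″ = q , step e p , e″

  fwd : ∀ {x y} → DWalk arc x y → UWalk arc x y
  fwd here       = here
  fwd (step e w) = step (inj₁ e) (fwd w)

  fwd-reachable : ∀ {x y} (w : DWalk arc x y) → All (DWalk arc x) (vertices arc (fwd w))
  fwd-reachable here       = here ∷ []
  fwd-reachable (step e w) = here ∷ All.map (step e) (fwd-reachable w)

  revApp : ∀ {a b c} → DWalk arc a b → UWalk arc a c → UWalk arc b c
  revApp here       acc = acc
  revApp (step e w) acc = revApp w (step (inj₂ e) acc)

  ProperDescendant : Fin n → Fin n → Set
  ProperDescendant a y = Σ (Fin n) λ z → T (arc a z) × DWalk arc z y

  module _ {c ℓ : Level} (R : CommutativeRing c ℓ) (ψ : Fin n → Fin n → CommutativeRing.Carrier R) where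
    open CommutativeRing R
    open SetoidReasoning setoid

    walkSum-fwd-++ : ∀ {x y z} (p : DWalk arc x y) (q : DWalk arc y z) →
      walkSum arc R ψ (fwd (p ++ᵈ q)) ≈ walkSum arc R ψ (fwd p) + walkSum arc R ψ (fwd q)
    walkSum-fwd-++ here       q = sym (+-identityˡ _)
    walkSum-fwd-++ (step e p) q = trans (+-congˡ (walkSum-fwd-++ p q)) (sym (+-assoc _ _ _))

    walkSum-revApp : (∀ {x y} → T (arc x y) → edgeVal arc R ψ y x ≡ edgeVal arc R ψ x y) →
      ∀ {a b c} (w : DWalk arc a b) (acc : UWalk arc a c) →
      walkSum arc R ψ (revApp w acc) ≈ walkSum arc R ψ (fwd w) + walkSum arc R ψ acc
    walkSum-revApp edgeVal-sym here       acc = sym (+-identityˡ _)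
    walkSum-revApp edgeVal-sym (step {x} {z} e w) acc = begin
      walkSum arc R ψ (revApp w (step (inj₂ e) acc))
        ≈⟨ walkSum-revApp edgeVal-sym w (step (inj₂ e) acc) ⟩
      W + (edgeVal arc R ψ z x + A)
        ≈⟨ +-congˡ (+-congʳ (reflexive (edgeVal-sym e))) ⟩
      W + (edgeVal arc R ψ x z + A)
        ≈⟨ +-assoc W _ A ⟨
      (W + edgeVal arc R ψ x z) + A
        ≈⟨ +-congʳ (+-comm W _) ⟩
      (edgeVal arc R ψ x z + W) + A ∎
      where
      W = walkSum arc R ψ (fwd w)
      A = walkSum arc R ψ acc

module Arborescence {n : ℕ} {arc : Digraph n} {r : Fin n} (arb : IsArborescence arc r) where
  open IsArborescence arb
  open Walks arc

  parent-unique : ∀ {u w v} → T (arc u v) → T (arc w v) → w ≡ u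
  parent-unique {u} {w} {v} u→v w→v
    with other-indeg1 v (λ v≡r → root-indeg0 u (subst (λ t → T (arc u t)) v≡r u→v))
  ... | _ , _ , unique = ≡.trans (unique w w→v) (≡.sym (unique u u→v))

  OnCycle : Fin n → Set
  OnCycle x = Σ (Fin n) λ z → T (arc x z) × DWalk arc z x

  -- The cycle through x is rotated one step back along a ⇝ x, using that the
  -- edge entering the predecessor on the cycle is its unique parent edge.
  ancestor-onCycle : ∀ {a x} → DWalk arc a x → OnCycle x → OnCycle a
  ancestor-onCycle here cyc = cyc
  ancestor-onCycle (step {z = z} a→z w) cyc with ancestor-onCycle w cyc
  ... | _ , z→z′ , z′⇝z with unsnoc z→z′ z′⇝z
  ... | _ , z⇝q , q→z = z , a→z , subst (DWalk arc z) (parent-unique a→z q→z) z⇝q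

  acyclic : ∀ {x z} → T (arc x z) → ¬ DWalk arc z x
  acyclic x→z z⇝x with ancestor-onCycle (reachable _) (_ , x→z , z⇝x)
  ... | _ , r→z′ , z′⇝r with unsnoc r→z′ z′⇝r
  ... | q , _ , q→r = root-indeg0 q q→r

  ancestors-comparable : ∀ {a b x} → DWalk arc a x → DWalk arc b x → DWalk arc a b ⊎ DWalk arc b a
  ancestors-comparable here b⇝x = inj₂ b⇝x
  ancestors-comparable (step a→z z⇝x) b⇝x with ancestors-comparable z⇝x b⇝x
  ... | inj₁ z⇝b         = inj₁ (step a→z z⇝b)
  ... | inj₂ here        = inj₁ (step a→z here)
  ... | inj₂ (step b→y y⇝z) with unsnoc b→y y⇝z
  ...   | _ , b⇝q , q→z = inj₂ (subst (DWalk arc _) (parent-unique a→z q→z) b⇝q)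

  sibling-unreachable : ∀ {v c₁ c₂} → T (arc v c₁) → T (arc v c₂) → c₁ ≢ c₂ → ¬ DWalk arc c₁ c₂
  sibling-unreachable _     _     c₁≢c₂ here = c₁≢c₂ refl
  sibling-unreachable v→c₁ v→c₂ _ (step c₁→z z⇝c₂) with unsnoc c₁→z z⇝c₂
  ... | _ , c₁⇝q , q→c₂ = acyclic v→c₁ (subst (DWalk arc _) (parent-unique v→c₂ q→c₂) c₁⇝q)

  siblings-disjoint : ∀ {v c₁ c₂ x} → T (arc v c₁) → T (arc v c₂) → c₁ ≢ c₂ →
                      DWalk arc c₁ x → ¬ DWalk arc c₂ x
  siblings-disjoint v→c₁ v→c₂ c₁≢c₂ c₁⇝x c₂⇝x with ancestors-comparable c₁⇝x c₂⇝x
  ... | inj₁ c₁⇝c₂ = sibling-unreachable v→c₁ v→c₂ c₁≢c₂ c₁⇝c₂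
  ... | inj₂ c₂⇝c₁ = sibling-unreachable v→c₂ v→c₁ (λ eq → c₁≢c₂ (≡.sym eq)) c₂⇝c₁

  fwd-isPath : ∀ {x y} (w : DWalk arc x y) → IsPath arc (fwd w)
  fwd-isPath here = [] ∷ []
  fwd-isPath (step x→z w) =
    All.map (λ z⇝y x≡y → acyclic x→z (subst (DWalk arc _) (≡.sym x≡y) z⇝y)) (fwd-reachable w)
    ∷ fwd-isPath w

  leaf-below : ∀ v → Σ (Fin n) λ y → DWalk arc v y × IsLeaf arc y
  leaf-below v = descend n v (λ w → Unique⇒length≤ (fwd-isPath w))
    where
    descend : ∀ k v → (∀ {y} (w : DWalk arc v y) → length (vertices arc (fwd w)) ≤ k) →
              Σ (Fin n) λ y → DWalk arc v y × IsLeaf arc y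
    descend k v bound with any? (λ w → T? (arc v w))
    ... | no ¬child = v , here , λ w e → ¬child (w , e)
    descend zero    v bound | yes _ with bound here
    ... | ()
    descend (suc k) v bound | yes (c , v→c) with descend k c (λ w → ℕ.≤-pred (bound (step v→c w)))
    ... | y , c⇝y , leaf = y , step v→c c⇝y , leaf

  -- Walking back along a ⇝ b keeps a path a path, provided the path avoids the
  -- proper descendants of a: the vertices of a ⇝ b other than a are exactly such.
  revApp-isPath : ∀ {a b c} (w : DWalk arc a b) (acc : UWalk arc a c) → IsPath arc acc →
    All (λ y → ¬ ProperDescendant a y) (vertices arc acc) → IsPath arc (revApp w acc)
  revApp-isPath here acc acc! avoid = acc!
  revApp-isPath (step {z = z} a→z w) acc acc! avoid =
    revApp-isPath w (step (inj₂ a→z) acc)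
      (All.map (λ ¬desc z≡y → ¬desc (z , a→z , subst (DWalk arc z) z≡y here)) avoid ∷ acc!)
      ((λ (_ , z→z′ , z′⇝z) → acyclic z→z′ z′⇝z)
       ∷ All.map (λ ¬desc (z′ , z→z′ , z′⇝y) → ¬desc (z , a→z , step z→z′ z′⇝y)) avoid)

  vee : ∀ {v c₁ c₂ x y} → T (arc v c₁) → T (arc v c₂) → DWalk arc c₁ x → DWalk arc c₂ y → UWalk arc x y
  vee v→c₁ v→c₂ c₁⇝x c₂⇝y = revApp (step v→c₁ c₁⇝x) (fwd (step v→c₂ c₂⇝y))

  vee-isPath : ∀ {v c₁ c₂ x y} (v→c₁ : T (arc v c₁)) (v→c₂ : T (arc v c₂)) → c₁ ≢ c₂ →
               (c₁⇝x : DWalk arc c₁ x) (c₂⇝y : DWalk arc c₂ y) → IsPath arc (vee v→c₁ v→c₂ c₁⇝x c₂⇝y)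
  vee-isPath v→c₁ v→c₂ c₁≢c₂ c₁⇝x c₂⇝y = revApp-isPath c₁⇝x _ (c₁∉ ∷ fwd-isPath (step v→c₂ c₂⇝y)) avoid
    where
    c₁∉ : All (_ ≢_) (vertices arc (fwd (step v→c₂ c₂⇝y)))
    c₁∉ = (λ c₁≡v → acyclic v→c₁ (subst (DWalk arc _) c₁≡v here))
          ∷ All.map (λ c₂⇝z c₁≡z → siblings-disjoint v→c₁ v→c₂ c₁≢c₂ (subst (DWalk arc _) c₁≡z here) c₂⇝z)
                    (fwd-reachable c₂⇝y)
    avoid : All (λ z → ¬ ProperDescendant _ z) (vertices arc (step (inj₂ v→c₁) (fwd (step v→c₂ c₂⇝y))))
    avoid = (λ (_ , c₁→z , z⇝c₁) → acyclic c₁→z z⇝c₁)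
          ∷ (λ (_ , c₁→z , z⇝v) → acyclic v→c₁ (step c₁→z z⇝v))
          ∷ All.map (λ c₂⇝z (_ , c₁→z′ , z′⇝z) → siblings-disjoint v→c₁ v→c₂ c₁≢c₂ (step c₁→z′ z′⇝z) c₂⇝z)
                    (fwd-reachable c₂⇝y)

  module _ {c ℓ : Level} (R : CommutativeRing c ℓ) (ψ : Fin n → Fin n → CommutativeRing.Carrier R) where
    open CommutativeRing R

    edgeVal-forward : ∀ {x y} → T (arc x y) → edgeVal arc R ψ x y ≡ ψ x y
    edgeVal-forward = if-true

    edgeVal-sym : ∀ {x y} → T (arc x y) → edgeVal arc R ψ y x ≡ edgeVal arc R ψ x y
    edgeVal-sym x→y = ≡.trans (if-false (λ y→x → acyclic x→y (step y→x here))) (≡.sym (if-true x→y))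

    walkSum-vee : ∀ {v c₁ c₂ x y} (v→c₁ : T (arc v c₁)) (v→c₂ : T (arc v c₂))
      (c₁⇝x : DWalk arc c₁ x) (c₂⇝y : DWalk arc c₂ y) →
      walkSum arc R ψ (vee v→c₁ v→c₂ c₁⇝x c₂⇝y)
        ≈ walkSum arc R ψ (fwd (step v→c₁ c₁⇝x)) + walkSum arc R ψ (fwd (step v→c₂ c₂⇝y))
    walkSum-vee v→c₁ v→c₂ c₁⇝x c₂⇝y = walkSum-revApp R ψ edgeVal-sym (step v→c₁ c₁⇝x) _

module Potential {c ℓ : Level} (R : CommutativeRing c ℓ) (torsionFree : TorsionFree R)
  {n : ℕ} {arc : Digraph n} {r : Fin n} (arb : IsArborescence arc r)
  (ψ : Fin n → Fin n → CommutativeRing.Carrier R) {m : ℕ} (φ : Fin m → Fin n)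
  (root-labeled : Σ (Fin m) λ u → φ u ≡ r)
  (internal-branches : ∀ v → IsInternal arc r v → OutDeg2 arc v)
  (leaf-labeled : ∀ v → IsLeaf arc v → Σ (Fin m) λ u → φ u ≡ v)
  (labeled-paths : ∀ s t (w : UWalk arc (φ s) (φ t)) → IsPath arc w →
    CommutativeRing._≈_ R (walkSum arc R ψ w) (CommutativeRing.0# R)) where

  open CommutativeRing R renaming (refl to ≈-refl)
  open IsArborescence arb using (reachable)
  open Walks arc
  open Arborescence arb

  -- Any directed walk from the root is the root path, so this says h v = 0.
  ZeroPotential : Fin n → Set ℓ
  ZeroPotential v = (w : DWalk arc r v) → walkSum arc R ψ (fwd w) ≈ 0#

  Labeled : Fin n → Set
  Labeled x = Σ (Fin m) λ s → φ s ≡ x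

  labeled-path : ∀ {x y} → Labeled x → Labeled y →
                 (w : UWalk arc x y) → IsPath arc w → walkSum arc R ψ w ≈ 0#
  labeled-path (s , refl) (t , refl) = labeled-paths s t

  root-potential : ZeroPotential r
  root-potential here              = ≈-refl
  root-potential (step r→z z⇝r) = ⊥-elim (acyclic r→z z⇝r)

  leaf-potential : ∀ {l} → IsLeaf arc l → ZeroPotential l
  leaf-potential leaf w = labeled-path root-labeled (leaf-labeled _ leaf) (fwd w) (fwd-isPath w)

  internal-potential : ∀ {v} → IsInternal arc r v → ZeroPotential v
  internal-potential {v} internal w
    with internal-branches v internal
  ... | c₁ , c₂ , c₁≢c₂ , v→c₁ , v→c₂ , _
    with leaf-below c₁ | leaf-below c₂
  ... | l₁ , c₁⇝l₁ , leaf₁ | l₂ , c₂⇝l₂ , leaf₂ =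
    torsionFree 1 h (trans (+-congˡ (+-identityʳ h)) (pairwise-ε⇒x∙x≈ε +-commutativeMonoid h+d₁ h+d₂ d₁+d₂))
    where
    h = walkSum arc R ψ (fwd w)
    d₁ = walkSum arc R ψ (fwd (step v→c₁ c₁⇝l₁))
    d₂ = walkSum arc R ψ (fwd (step v→c₂ c₂⇝l₂))

    root-to-leaf : ∀ {c l} (v→c : T (arc v c)) (c⇝l : DWalk arc c l) → IsLeaf arc l →
                   h + walkSum arc R ψ (fwd (step v→c c⇝l)) ≈ 0#
    root-to-leaf v→c c⇝l leaf = trans (sym (walkSum-fwd-++ R ψ w (step v→c c⇝l)))
                                       (leaf-potential leaf (w ++ᵈ step v→c c⇝l))

    h+d₁ : h + d₁ ≈ 0#
    h+d₁ = root-to-leaf v→c₁ c₁⇝l₁ leaf₁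

    h+d₂ : h + d₂ ≈ 0#
    h+d₂ = root-to-leaf v→c₂ c₂⇝l₂ leaf₂

    d₁+d₂ : d₁ + d₂ ≈ 0#
    d₁+d₂ = trans (sym (walkSum-vee R ψ v→c₁ v→c₂ c₁⇝l₁ c₂⇝l₂))
                  (labeled-path (leaf-labeled _ leaf₁) (leaf-labeled _ leaf₂) _
                                (vee-isPath v→c₁ v→c₂ c₁≢c₂ c₁⇝l₁ c₂⇝l₂))

  potential : ∀ v → ZeroPotential v
  potential v with v ≟ r | any? (λ w → T? (arc v w))
  ... | yes refl | _            = root-potential
  ... | no v≢r   | yes (c , v→c) = internal-potential (v≢r , λ leaf → leaf c v→c)
  ... | no _     | no ¬child    = leaf-potential (λ w v→w → ¬child (w , v→w))

  edge-zero : ∀ u v → T (arc u v) → ψ u v ≈ 0#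
  edge-zero u v u→v = begin
    ψ u v                   ≈⟨ reflexive (edgeVal-forward R ψ u→v) ⟨
    edgeVal arc R ψ u v      ≈⟨ +-identityʳ _ ⟨
    edgeVal arc R ψ u v + 0# ≈⟨ x≈ε∧x∙y≈ε⇒y≈ε +-commutativeMonoid (potential u (reachable u)) h+ψ ⟩
    0#                      ∎
    where
    open SetoidReasoning setoid
    h+ψ : walkSum arc R ψ (fwd (reachable u)) + walkSum arc R ψ (fwd (step u→v here)) ≈ 0#
    h+ψ = trans (sym (walkSum-fwd-++ R ψ (reachable u) (step u→v here)))
                (potential v (reachable u ++ᵈ step u→v here))

lemma5p7 : {c ℓ : Level} (R : CommutativeRing c ℓ) → TorsionFree R →
    (n : ℕ) (arc : Digraph n) (r : Fin n) → IsArborescence arc r →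
    (ψ : Fin n → Fin n → CommutativeRing.Carrier R) →
    (m : ℕ) (φ : Fin m → Fin n) →
    (Σ (Fin m) λ u → φ u ≡ r) → OutDeg1 arc r →
    (∀ v → IsInternal arc r v → (∀ u → ¬ (φ u ≡ v)) × OutDeg2 arc v) →
    (∀ v → IsLeaf arc v → Σ (Fin m) λ u → φ u ≡ v) →
    (∀ s t (w : UWalk arc (φ s) (φ t)) → IsPath arc w →
      CommutativeRing._≈_ R (walkSum arc R ψ w) (CommutativeRing.0# R)) →
    ∀ u v → T (arc u v) → CommutativeRing._≈_ R (ψ u v) (CommutativeRing.0# R)
lemma5p7 R torsionFree n arc r arb ψ m φ root-labeled _ internal leaf-labeled labeled-paths =
  Potential.edge-zero R torsionFree arb ψ φ root-labeled
    (λ v v-internal → proj₂ (internal v v-internal)) leaf-labeled labeled-paths
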